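{- For all integers $a \ge 1$ and $b \ge 0$, every graph $G_{a,b}$ (for any circular arrangement of the copies) satisfies $$m_3(G_{a,b}) = \frac{4a+2b}{5a+2b}.$$
   Context: A multipole is a cubic graph that may have dangling edges (edges with only one end incident with a vertex); a $2$-pole has two dangling edges. Let $A$ be the $2$-pole obtained from the Petersen graph, and $B$ the $2$-pole obtained from $K_4$, by cutting one edge $uv$ into a dangling edge at $u$ and a dangling edge at $v$. The graph $G_{a,b}$ is obtained by taking $a$ copies of $A$ and $b$ copies of $B$, placing them in an arbitrary cyclic order, and for each pair of cyclically consecutive copies joining one dangling edge of the first to one dangling edge of the next into a single edge, so that each copy has one dangling edge joined to the previous copy and the other joined to the next copy (if there is only one copy, its two dangling edges are joined to each other). For a bridgeless cubic graph $G$, $m_3(G)$ denotes the maximum number of edges of $G$ contained in the union of three perfect matchings of $G$, divided by $|E(G)|$. -}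

module Defs where

open import Data.Nat using (ℕ; zero; suc; _+_; _*_; _≤_)
open import Data.Bool using (Bool; true; false)
open import Data.Fin using (Fin)
open import Data.Fin.Subset using (Subset; _∈_; _∪_; ∣_∣)
open import Data.List using (List; []; _∷_; _++_; length; map; zipWith; lookup; concat)
open import Data.Product using (Σ; _×_; _,_; proj₁; proj₂; ∃)
open import Data.Sum using (_⊎_)
open import Relation.Binary.PropositionalEquality using (_≡_)

-- Finite (multi)graphs: vertices 0 … nV-1, edges indexed by Fin (length edges),
-- each edge given by its two endpoints.

record Graph : Set where
  field
    nV    : ℕ
    edges : List (ℕ × ℕ)

open Graph public

nE : Graph → ℕ
nE G = length (edges G)

EdgeSet : Graph → Set
EdgeSet G = Subset (nE G)

Incident : (G : Graph) → ℕ → Fin (nE G) → Set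
Incident G v e = (v ≡ proj₁ (lookup (edges G) e)) ⊎ (v ≡ proj₂ (lookup (edges G) e))

IsPerfectMatching : (G : Graph) → EdgeSet G → Set
IsPerfectMatching G M =
  (v : ℕ) → suc v ≤ nV G →
    (Σ (Fin (nE G)) λ e → e ∈ M × Incident G v e)
    × ((e e′ : Fin (nE G)) → e ∈ M → Incident G v e → e′ ∈ M → Incident G v e′ → e ≡ e′)

IsMaxCover3 : Graph → ℕ → Set
IsMaxCover3 G k =
  (Σ (EdgeSet G) λ M₁ → Σ (EdgeSet G) λ M₂ → Σ (EdgeSet G) λ M₃ →
     IsPerfectMatching G M₁ × IsPerfectMatching G M₂ × IsPerfectMatching G M₃
     × ∣ M₁ ∪ M₂ ∪ M₃ ∣ ≡ k)
  × ((M₁ M₂ M₃ : EdgeSet G) →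
     IsPerfectMatching G M₁ → IsPerfectMatching G M₂ → IsPerfectMatching G M₃ →
     ∣ M₁ ∪ M₂ ∪ M₃ ∣ ≤ k)

-- m₃(G) = p / q   (stated by cross-multiplication: m₃(G) = k / |E(G)| with k the maximum).
m3≡ : Graph → ℕ → ℕ → Set
m3≡ G p q = Σ ℕ λ k → IsMaxCover3 G k × k * q ≡ p * nE G

-- The 2-poles A (Petersen minus edge 0–1) and B (K₄ minus edge 0–1).
-- Petersen: outer cycle 0..4, spokes i–(i+5), inner pentagram (5+i)–(5+(i+2 mod 5)).
-- Cut edge uv = 0–1 in both; dangling edges at u = 0 and v = 1.

data Kind : Set where
  kA kB : Kind

size : Kind → ℕ
size kA = 10
size kB = 4

internal : Kind → List (ℕ × ℕ)
internal kA =
  (1 , 2) ∷ (2 , 3) ∷ (3 , 4) ∷ (4 , 0) ∷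
  (0 , 5) ∷ (1 , 6) ∷ (2 , 7) ∷ (3 , 8) ∷ (4 , 9) ∷
  (5 , 7) ∷ (6 , 8) ∷ (7 , 9) ∷ (8 , 5) ∷ (9 , 6) ∷ []
internal kB = (0 , 2) ∷ (0 , 3) ∷ (1 , 2) ∷ (1 , 3) ∷ (2 , 3) ∷ []

-- A copy in the cyclic arrangement: its kind, and which of its two dangling
-- edges (at u or at v) is joined to the previous copy (false: u, true: v).
Arrangement : Set
Arrangement = List (Kind × Bool)

countA : Arrangement → ℕ
countA [] = 0
countA ((kA , _) ∷ xs) = suc (countA xs)
countA ((kB , _) ∷ xs) = countA xs

countB : Arrangement → ℕ
countB [] = 0
countB ((kA , _) ∷ xs) = countB xs
countB ((kB , _) ∷ xs) = suc (countB xs)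

shift : ℕ → ℕ × ℕ → ℕ × ℕ
shift o (x , y) = (o + x , o + y)

-- ports of a copy at offset o: (vertex joined to previous, vertex joined to next)
ports : ℕ → Bool → ℕ × ℕ
ports o false = (o + 0 , o + 1)
ports o true  = (o + 1 , o + 0)

totalV : Arrangement → ℕ
totalV [] = 0
totalV ((k , _) ∷ xs) = size k + totalV xs

internalEdges : ℕ → Arrangement → List (ℕ × ℕ)
internalEdges o [] = []
internalEdges o ((k , _) ∷ xs) = map (shift o) (internal k) ++ internalEdges (o + size k) xs

portList : ℕ → Arrangement → List (ℕ × ℕ)
portList o [] = []
portList o ((k , f) ∷ xs) = ports o f ∷ portList (o + size k) xs

rotate : {A : Set} → List A → List A
rotate [] = []
rotate (x ∷ xs) = xs ++ (x ∷ [])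

-- join the "next" dangling edge of copy i with the "previous" dangling edge of copy i+1 (cyclically)
connecting : List (ℕ × ℕ) → List (ℕ × ℕ)
connecting ps = zipWith (λ p q → (proj₂ p , proj₁ q)) ps (rotate ps)

Gab : Arrangement → Graph
Gab arr = record
  { nV    = totalV arr
  ; edges = internalEdges 0 arr ++ connecting (portList 0 arr)
  }

-- A perfect matching of G_{a,b} amounts to a perfect matching of every copy of a 2-pole
-- together with its dangling edges, such that consecutive copies agree on the edge joining
-- them.  Charge every edge to the copy containing it or, for a joining edge, to the copy
-- preceding it: a copy of A carries 15 edges and a copy of B carries 6.  By exhaustive
-- search, the perfect matchings of A with its dangling edges are the six perfect matchings
-- of the Petersen graph (the cut edge uv standing for both dangling edges), any two of which
-- share exactly one edge, so three perfect matchings of G_{a,b} cover at most 12 of the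
-- edges charged to a copy of A, and at most all 6 for a copy of B.  Conversely, three
-- Petersen matchings pairwise meeting in one edge, the first containing uv, in every copy of
-- A, and three perfect matchings of K₄ in every copy of B glue to three perfect matchings of
-- G_{a,b} covering 12a + 6b of its 15a + 6b edges;
-- and (12a + 6b)/(15a + 6b) = (4a + 2b)/(5a + 2b).

module Submission where

open import Defs
open import Algebra.Properties.CommutativeSemigroup using (interchange; xy∙z≈xz∙y)
open import Data.Bool using (Bool; true; false; not; _∧_; _∨_; T)
open import Data.Bool.Properties as Bool using (T-∨; T-≡; ∧-zeroʳ)
open import Data.Empty using (⊥-elim)
open import Data.Fin using (Fin; zero; suc; toℕ)
import Data.Fin.Properties as Fin
open import Data.Fin.Subset using (Subset; _∈_; _∪_; ∣_∣)
open import Data.Fin.Subset.Properties using (anySubset?; ∣p∣≤n)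
open import Data.List as List using (List; []; _∷_; _++_; [_]; length; lookup; map)
import Data.List.Properties as List
open import Data.List.Relation.Unary.All as All using (All; []; _∷_)
open import Data.List.Relation.Unary.All.Properties using (++⁺)
open import Data.Nat using (ℕ; zero; suc; _+_; _*_; _≤_; _<_; z≤n; s≤s; _≡ᵇ_; _≟_; _≤?_; _<?_)
open import Data.Nat.Properties
open import Data.Nat.Tactic.RingSolver using (solve-∀)
open import Data.Product as Product using (Σ; _×_; _,_; proj₁; proj₂; uncurry)
open import Data.Product.Properties using (≡-dec)
open import Data.Sum as Sum using (_⊎_)
open import Data.Unit using (⊤; tt)
open import Data.Vec as Vec using (Vec; []; _∷_; head; tail; here; there; zipWith)
import Data.Vec.Properties as Vec
open import Function using (_∘_; Equivalence)
open import Relation.Binary.PropositionalEquality using (_≡_; _≢_; refl; sym; trans; cong; cong₂; subst; subst₂; ≢-sym; module ≡-Reasoning)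
open import Relation.Nullary using (Dec; yes; no; ¬?)
open import Relation.Nullary.Decidable using (True; map′; decidable-stable; toWitness; _×-dec_; _→-dec_)
open import Relation.Unary using (Decidable)

private variable
  A B C X : Set

-- Degrees and perfect matchings

ind : Bool → ℕ
ind true  = 1
ind false = 0

Edge : Set
Edge = ℕ × ℕ

incident? : ℕ → Edge → Bool
incident? v (x , y) = (v ≡ᵇ x) ∨ (v ≡ᵇ y)

IncidentTo : (L : List Edge) → ℕ → Fin (length L) → Set
IncidentTo L v e = (v ≡ proj₁ (lookup L e)) ⊎ (v ≡ proj₂ (lookup L e))

incident?-sound : ∀ v x y → T (incident? v (x , y)) → (v ≡ x) ⊎ (v ≡ y)
incident?-sound v x y = Sum.map (≡ᵇ⇒≡ v x) (≡ᵇ⇒≡ v y) ∘ Equivalence.to T-∨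

incident?-complete : ∀ v x y → (v ≡ x) ⊎ (v ≡ y) → T (incident? v (x , y))
incident?-complete v x y = Equivalence.from T-∨ ∘ Sum.map (≡⇒≡ᵇ v x) (≡⇒≡ᵇ v y)

-- The edges of L are translated by o.  Translation by 0 is definitionally the identity,
-- and head/tail (rather than patterns on M) let the sum unfold on any concrete L.
offsetDegree : ℕ → (L : List Edge) → Subset (length L) → ℕ → ℕ
offsetDegree o []      M v = 0
offsetDegree o (e ∷ L) M v = ind (incident? v (shift o e) ∧ head M) + offsetDegree o L (tail M) v

degree : (L : List Edge) → Subset (length L) → ℕ → ℕ
degree = offsetDegree 0

UniquelyCovered : (L : List Edge) → Subset (length L) → ℕ → Set
UniquelyCovered L M v =
  (e e′ : Fin (length L)) → e ∈ M → IncidentTo L v e → e′ ∈ M → IncidentTo L v e′ → e ≡ e′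

∈-incident⇒1≤degree : ∀ L M v e → e ∈ M → IncidentTo L v e → 1 ≤ degree L M v
∈-incident⇒1≤degree ((x , y) ∷ L) (true ∷ M) v zero here i
  rewrite Equivalence.to T-≡ (incident?-complete v x y i) = s≤s z≤n
∈-incident⇒1≤degree (_ ∷ L) (_ ∷ M) v (suc e) (there p) i =
  ≤-trans (∈-incident⇒1≤degree L M v e p i) (m≤n+m _ _)

1≤degree⇒∈-incident : ∀ L M v → 1 ≤ degree L M v → Σ (Fin (length L)) λ e → e ∈ M × IncidentTo L v e
1≤degree⇒∈-incident ((x , y) ∷ L) (b ∷ M) v d with incident? v (x , y) in inc | b
... | true  | true = zero , here , incident?-sound v x y (subst T (sym inc) _)
... | true  | false = Product.map suc (Product.map₁ there) (1≤degree⇒∈-incident L M v d)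
... | false | true  = Product.map suc (Product.map₁ there) (1≤degree⇒∈-incident L M v d)
... | false | false = Product.map suc (Product.map₁ there) (1≤degree⇒∈-incident L M v d)

uniquelyCovered-tail : ∀ {e L b M v} → UniquelyCovered (e ∷ L) (b ∷ M) v → UniquelyCovered L M v
uniquelyCovered-tail u e e′ p i p′ i′ = Fin.suc-injective (u (suc e) (suc e′) (there p) i (there p′) i′)

unique⇒degree≤1 : ∀ L M v → UniquelyCovered L M v → degree L M v ≤ 1
unique⇒degree≤1 [] [] v u = z≤n
unique⇒degree≤1 ((x , y) ∷ L) (b ∷ M) v u with incident? v (x , y) in inc | b
... | true  | true  = s≤s (≮⇒≥ (λ d → let (e , p , i) = 1≤degree⇒∈-incident L M v d in
    0≢1+n (cong toℕ (u zero (suc e) here (incident?-sound v x y (subst T (sym inc) _)) (there p) i))))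
... | true  | false = unique⇒degree≤1 L M v (uniquelyCovered-tail u)
... | false | true  = unique⇒degree≤1 L M v (uniquelyCovered-tail u)
... | false | false = unique⇒degree≤1 L M v (uniquelyCovered-tail u)

degree≤1⇒unique : ∀ L M v → degree L M v ≤ 1 → UniquelyCovered L M v
degree≤1⇒unique (_ ∷ L) (b ∷ M) v d zero zero p i p′ i′ = refl
degree≤1⇒unique ((x , y) ∷ L) (true ∷ M) v d zero (suc e′) here i (there p′) i′
  rewrite Equivalence.to T-≡ (incident?-complete v x y i) =
  ⊥-elim (<⇒≱ (∈-incident⇒1≤degree L M v e′ p′ i′) (≤-pred d))
degree≤1⇒unique ((x , y) ∷ L) (true ∷ M) v d (suc e) zero (there p) i here i′
  rewrite Equivalence.to T-≡ (incident?-complete v x y i′) =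
  ⊥-elim (<⇒≱ (∈-incident⇒1≤degree L M v e p i) (≤-pred d))
degree≤1⇒unique (_ ∷ L) (b ∷ M) v d (suc e) (suc e′) (there p) i (there p′) i′ =
  cong suc (degree≤1⇒unique L M v (≤-trans (m≤n+m _ _) d) e e′ p i p′ i′)

perfectMatching⇒degree≡1 : ∀ G M → IsPerfectMatching G M → ∀ v → v < nV G → degree (edges G) M v ≡ 1
perfectMatching⇒degree≡1 G M pm v v<n = let ((e , p , i) , u) = pm v v<n in
  ≤-antisym (unique⇒degree≤1 (edges G) M v u) (∈-incident⇒1≤degree (edges G) M v e p i)

degree≡1⇒perfectMatching : ∀ G M → (∀ v → v < nV G → degree (edges G) M v ≡ 1) → IsPerfectMatching G M
degree≡1⇒perfectMatching G M deg v v<n =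
  1≤degree⇒∈-incident (edges G) M v (≤-reflexive (sym (deg v v<n))) ,
  degree≤1⇒unique (edges G) M v (≤-reflexive (deg v v<n))

-- Splitting edge sets along the layout of G_{a,b}

split : (L₁ L₂ : List X) → Vec A (length (L₁ ++ L₂)) → Vec A (length L₁) × Vec A (length L₂)
split []       L₂ v       = [] , v
split (_ ∷ L₁) L₂ (a ∷ v) = Product.map₁ (a ∷_) (split L₁ L₂ v)

join : (L₁ L₂ : List X) → Vec A (length L₁) → Vec A (length L₂) → Vec A (length (L₁ ++ L₂))
join []       L₂ []      r = r
join (_ ∷ L₁) L₂ (a ∷ l) r = a ∷ join L₁ L₂ l r

split-join : (L₁ L₂ : List X) (l : Vec A (length L₁)) (r : Vec A (length L₂)) →
             split L₁ L₂ (join L₁ L₂ l r) ≡ (l , r)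
split-join []       L₂ []      r = refl
split-join (_ ∷ L₁) L₂ (a ∷ l) r = cong (Product.map₁ (a ∷_)) (split-join L₁ L₂ l r)

split-zipWith : (f : A → B → C) (L₁ L₂ : List X) (u : Vec A (length (L₁ ++ L₂))) (v : Vec B (length (L₁ ++ L₂))) →
  split L₁ L₂ (zipWith f u v) ≡
  (zipWith f (proj₁ (split L₁ L₂ u)) (proj₁ (split L₁ L₂ v)) , zipWith f (proj₂ (split L₁ L₂ u)) (proj₂ (split L₁ L₂ v)))
split-zipWith f []       L₂ u       v       = refl
split-zipWith f (_ ∷ L₁) L₂ (a ∷ u) (b ∷ v) = cong (Product.map₁ (f a b ∷_)) (split-zipWith f L₁ L₂ u v)

∣∣-split : (L₁ L₂ : List X) (M : Subset (length (L₁ ++ L₂))) →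
           ∣ M ∣ ≡ ∣ proj₁ (split L₁ L₂ M) ∣ + ∣ proj₂ (split L₁ L₂ M) ∣
∣∣-split []       L₂ M           = refl
∣∣-split (_ ∷ L₁) L₂ (true  ∷ M) = cong suc (∣∣-split L₁ L₂ M)
∣∣-split (_ ∷ L₁) L₂ (false ∷ M) = ∣∣-split L₁ L₂ M

offsetDegree-split : ∀ o (L₁ L₂ : List Edge) (M : Subset (length (L₁ ++ L₂))) v →
  offsetDegree o (L₁ ++ L₂) M v ≡ offsetDegree o L₁ (proj₁ (split L₁ L₂ M)) v + offsetDegree o L₂ (proj₂ (split L₁ L₂ M)) v
offsetDegree-split o []       L₂ M       v = refl
offsetDegree-split o (e ∷ L₁) L₂ (b ∷ M) v =
  trans (cong (ind (incident? v (shift o e) ∧ b) +_) (offsetDegree-split o L₁ L₂ M v))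
        (sym (+-assoc (ind (incident? v (shift o e) ∧ b)) _ _))

Part : Set → Kind × Bool → Set
Part A c = Vec A (length (internal (proj₁ c)))

Parts : Set → Arrangement → Set
Parts A = All (Part A)

-- For a concrete kind, map (shift o) (internal k) has definitionally the length of internal k.
splitCopy : ∀ o k (L : List Edge) → Vec A (length (map (shift o) (internal k) ++ L)) →
            Vec A (length (internal k)) × Vec A (length L)
splitCopy o kA = split (map (shift o) (internal kA))
splitCopy o kB = split (map (shift o) (internal kB))

joinCopy : ∀ o k (L : List Edge) → Vec A (length (internal k)) → Vec A (length L) →
           Vec A (length (map (shift o) (internal k) ++ L))
joinCopy o kA = join (map (shift o) (internal kA))
joinCopy o kB = join (map (shift o) (internal kB))

splitCopy-joinCopy : ∀ o k L (l : Vec A (length (internal k))) (r : Vec A (length L)) →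
                     splitCopy o k L (joinCopy o k L l r) ≡ (l , r)
splitCopy-joinCopy o kA = split-join (map (shift o) (internal kA))
splitCopy-joinCopy o kB = split-join (map (shift o) (internal kB))

splitCopy-zipWith : (f : A → B → C) → ∀ o k L u v → splitCopy o k L (zipWith f u v) ≡
  (zipWith f (proj₁ (splitCopy o k L u)) (proj₁ (splitCopy o k L v)) ,
   zipWith f (proj₂ (splitCopy o k L u)) (proj₂ (splitCopy o k L v)))
splitCopy-zipWith f o kA = split-zipWith f (map (shift o) (internal kA))
splitCopy-zipWith f o kB = split-zipWith f (map (shift o) (internal kB))

∣∣-splitCopy : ∀ o k L (M : Subset (length (map (shift o) (internal k) ++ L))) →
               ∣ M ∣ ≡ ∣ proj₁ (splitCopy o k L M) ∣ + ∣ proj₂ (splitCopy o k L M) ∣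
∣∣-splitCopy o kA = ∣∣-split (map (shift o) (internal kA))
∣∣-splitCopy o kB = ∣∣-split (map (shift o) (internal kB))

degree-splitCopy : ∀ o k L (M : Subset (length (map (shift o) (internal k) ++ L))) v →
  degree (map (shift o) (internal k) ++ L) M v ≡
  offsetDegree o (internal k) (proj₁ (splitCopy o k L M)) v + degree L (proj₂ (splitCopy o k L M)) v
degree-splitCopy o kA = offsetDegree-split 0 (map (shift o) (internal kA))
degree-splitCopy o kB = offsetDegree-split 0 (map (shift o) (internal kB))

parts : ∀ o arr → Vec A (length (internalEdges o arr)) → Parts A arr
parts o []             M = []
parts o ((k , _) ∷ xs) M =
  proj₁ (splitCopy o k _ M) ∷ parts (o + size k) xs (proj₂ (splitCopy o k _ M))

unparts : ∀ o arr → Parts A arr → Vec A (length (internalEdges o arr))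
unparts o []             []      = []
unparts o ((k , _) ∷ xs) (m ∷ D) = joinCopy o k _ m (unparts (o + size k) xs D)

parts-unparts : ∀ o arr (D : Parts A arr) → parts o arr (unparts o arr D) ≡ D
parts-unparts o []             []      = refl
parts-unparts o ((k , _) ∷ xs) (m ∷ D)
  rewrite splitCopy-joinCopy o k (internalEdges (o + size k) xs) m (unparts (o + size k) xs D)
  = cong (m ∷_) (parts-unparts (o + size k) xs D)

parts-zipWith : (f : A → B → C) → ∀ o arr u v →
  parts o arr (zipWith f u v) ≡ All.zipWith (λ (m , m′) → zipWith f m m′) (parts o arr u , parts o arr v)
parts-zipWith f o []             u v = refl
parts-zipWith f o ((k , _) ∷ xs) u v
  rewrite splitCopy-zipWith f o k (internalEdges (o + size k) xs) u v
  = cong (zipWith f (proj₁ (splitCopy o k _ u)) (proj₁ (splitCopy o k _ v)) ∷_) (parts-zipWith f (o + size k) xs _ _)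

partsSize : ∀ {arr} → Parts Bool arr → ℕ
partsSize []      = 0
partsSize (m ∷ D) = ∣ m ∣ + partsSize D

∣∣-parts : ∀ o arr (M : Subset (length (internalEdges o arr))) → ∣ M ∣ ≡ partsSize (parts o arr M)
∣∣-parts o []             [] = refl
∣∣-parts o ((k , _) ∷ xs) M =
  trans (∣∣-splitCopy o k _ M) (cong (∣ proj₁ (splitCopy o k _ M) ∣ +_) (∣∣-parts (o + size k) xs _))

partsDegree : ∀ o arr → Parts Bool arr → ℕ → ℕ
partsDegree o []             []      v = 0
partsDegree o ((k , _) ∷ xs) (m ∷ D) v = offsetDegree o (internal k) m v + partsDegree (o + size k) xs D v

degree-parts : ∀ o arr (M : Subset (length (internalEdges o arr))) v →
               degree (internalEdges o arr) M v ≡ partsDegree o arr (parts o arr M) v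
degree-parts o []             [] v = refl
degree-parts o ((k , _) ∷ xs) M  v =
  trans (degree-splitCopy o k _ M v)
        (cong (offsetDegree o (internal k) (proj₁ (splitCopy o k _ M)) v +_) (degree-parts (o + size k) xs _ v))

hits : List ℕ → List Bool → ℕ → ℕ
hits _        []       v = 0
hits []       (_ ∷ _)  v = 0
hits (a ∷ as) (b ∷ bs) v = ind ((v ≡ᵇ a) ∧ b) + hits as bs v

link : List Edge → List Edge → List Edge
link = List.zipWith (λ p q → (proj₂ p , proj₁ q))

LoopFree : List Edge → List Edge → Set
LoopFree ps qs = All (λ p → All (λ q → proj₂ p ≢ proj₁ q) qs) ps

ind-incident? : ∀ x y v b → x ≢ y → ind (incident? v (x , y) ∧ b) ≡ ind ((v ≡ᵇ x) ∧ b) + ind ((v ≡ᵇ y) ∧ b)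
ind-incident? x y v b x≢y with v ≡ᵇ x in v≡x | v ≡ᵇ y in v≡y
... | true  | true  = ⊥-elim (x≢y (trans (sym (≡ᵇ⇒≡ v x (subst T (sym v≡x) _))) (≡ᵇ⇒≡ v y (subst T (sym v≡y) _))))
... | true  | false = sym (+-identityʳ _)
... | false | _     = refl

degree-link : ∀ ps qs (c : Subset (length (link ps qs))) v → LoopFree ps qs →
  degree (link ps qs) c v ≡ hits (map proj₂ ps) (Vec.toList c) v + hits (map proj₁ qs) (Vec.toList c) v
degree-link []       qs       []      v lf = refl
degree-link (p ∷ ps) []       []      v lf = refl
degree-link (p ∷ ps) (q ∷ qs) (b ∷ c) v (lfp ∷ lf) =
  trans (cong₂ _+_ (ind-incident? (proj₂ p) (proj₁ q) v b (All.head lfp)) (degree-link ps qs c v (All.map All.tail lf)))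
        (interchange +-commutativeSemigroup (ind ((v ≡ᵇ proj₂ p) ∧ b)) _ _ _)

lastOf : A → List A → A
lastOf x []       = x
lastOf _ (y ∷ ys) = lastOf y ys

initOf : A → List A → List A
initOf x []       = []
initOf x (y ∷ ys) = x ∷ initOf y ys

rotateʳ : List A → List A
rotateʳ []       = []
rotateʳ (x ∷ xs) = lastOf x xs ∷ initOf x xs

initOf-lastOf : ∀ (x : A) xs → x ∷ xs ≡ initOf x xs ++ [ lastOf x xs ]
initOf-lastOf x []       = refl
initOf-lastOf x (y ∷ ys) = cong (x ∷_) (initOf-lastOf y ys)

length-initOf : ∀ (x : A) xs → length (initOf x xs) ≡ length xs
length-initOf x []       = refl
length-initOf x (y ∷ ys) = cong suc (length-initOf y ys)

length-rotate : ∀ (xs : List A) → length (rotate xs) ≡ length xs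
length-rotate []       = refl
length-rotate (x ∷ xs) = trans (List.length-++ xs) (+-comm (length xs) 1)

hits-snoc : ∀ as bs a b v → length as ≡ length bs →
            hits (as ++ [ a ]) (bs ++ [ b ]) v ≡ hits as bs v + ind ((v ≡ᵇ a) ∧ b)
hits-snoc []       []       a b v eq = +-identityʳ _
hits-snoc (a′ ∷ as) (b′ ∷ bs) a b v eq =
  trans (cong (ind ((v ≡ᵇ a′) ∧ b′) +_) (hits-snoc as bs a b v (suc-injective eq)))
        (sym (+-assoc (ind ((v ≡ᵇ a′) ∧ b′)) _ _))

hits-rotate : ∀ as bs v → length bs ≡ length as → hits (rotate as) bs v ≡ hits as (rotateʳ bs) v
hits-rotate []       []       v eq = refl
hits-rotate (a ∷ as) (b ∷ bs) v eq =
  begin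
    hits (as ++ [ a ]) (b ∷ bs) v
  ≡⟨ cong (λ cs → hits (as ++ [ a ]) cs v) (initOf-lastOf b bs) ⟩
    hits (as ++ [ a ]) (initOf b bs ++ [ lastOf b bs ]) v
  ≡⟨ hits-snoc as (initOf b bs) a (lastOf b bs) v (trans (suc-injective (sym eq)) (sym (length-initOf b bs))) ⟩
    hits as (initOf b bs) v + ind ((v ≡ᵇ a) ∧ lastOf b bs)
  ≡⟨ +-comm (hits as (initOf b bs) v) _ ⟩
    hits (a ∷ as) (rotateʳ (b ∷ bs)) v
  ∎
  where open ≡-Reasoning

map-rotate : ∀ {B : Set} (f : A → B) xs → map f (rotate xs) ≡ rotate (map f xs)
map-rotate f []       = refl
map-rotate f (x ∷ xs) = List.map-++ f xs [ x ]

length-link : ∀ ps qs → length qs ≡ length ps → length (link ps qs) ≡ length ps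
length-link []       qs       eq = refl
length-link (p ∷ ps) (q ∷ qs) eq = cong suc (length-link ps qs (suc-injective eq))

length-connecting : ∀ ps → length (connecting ps) ≡ length ps
length-connecting ps = length-link ps (rotate ps) (length-rotate ps)

loopFree-rotate : ∀ ps qs → LoopFree ps qs → LoopFree ps (rotate qs)
loopFree-rotate ps []       lf = lf
loopFree-rotate ps (q ∷ qs) lf = All.map (λ a → ++⁺ (All.tail a) (All.head a ∷ [])) lf

degree-connecting : ∀ ps (c : Subset (length (connecting ps))) v → LoopFree ps ps →
  degree (connecting ps) c v ≡ hits (map proj₂ ps) (Vec.toList c) v + hits (map proj₁ ps) (rotateʳ (Vec.toList c)) v
degree-connecting ps c v lf =
  trans (degree-link ps (rotate ps) c v (loopFree-rotate ps ps lf))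
        (cong (hits (map proj₂ ps) (Vec.toList c) v +_)
              (trans (cong (λ as → hits as (Vec.toList c) v) (map-rotate proj₁ ps))
                     (hits-rotate (map proj₁ ps) (Vec.toList c) v
                        (trans (Vec.length-toList c) (trans (length-connecting ps) (sym (List.length-map proj₁ ps)))))))

AtLeast : ℕ → Edge → Set
AtLeast o p = o ≤ proj₁ p × o ≤ proj₂ p

2≤size : ∀ k → 2 ≤ size k
2≤size kA = s≤s (s≤s z≤n)
2≤size kB = s≤s (s≤s z≤n)

portList-atLeast : ∀ o arr → All (AtLeast o) (portList o arr)
portList-atLeast o []             = []
portList-atLeast o ((k , f) ∷ xs) =
  ports-atLeast f ∷ All.map (λ (x≥ , y≥) → ≤-trans (m≤m+n o (size k)) x≥ , ≤-trans (m≤m+n o (size k)) y≥)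
                            (portList-atLeast (o + size k) xs)
  where
  ports-atLeast : ∀ f → AtLeast o (ports o f)
  ports-atLeast false = m≤m+n o 0 , m≤m+n o 1
  ports-atLeast true  = m≤m+n o 1 , m≤m+n o 0

ports-below : ∀ o k f → proj₁ (ports o f) < o + size k × proj₂ (ports o f) < o + size k
ports-below o k false = +-monoʳ-< o (≤-trans (s≤s z≤n) (2≤size k)) , +-monoʳ-< o (2≤size k)
ports-below o k true  = +-monoʳ-< o (2≤size k) , +-monoʳ-< o (≤-trans (s≤s z≤n) (2≤size k))

ports-distinct : ∀ o f → proj₂ (ports o f) ≢ proj₁ (ports o f)
ports-distinct o false eq = 1+n≢0 (+-cancelˡ-≡ o _ _ eq)
ports-distinct o true  eq = 1+n≢0 (+-cancelˡ-≡ o _ _ (sym eq))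

loopFree-portList : ∀ o arr → LoopFree (portList o arr) (portList o arr)
loopFree-portList o []             = []
loopFree-portList o ((k , f) ∷ xs) =
  (ports-distinct o f ∷ All.map (λ (x≥ , _) eq → <⇒≢ (<-≤-trans (proj₂ below) x≥) eq) later)
  ∷ All.zipWith (λ ((_ , y≥) , rest) → (λ eq → <⇒≢ (<-≤-trans (proj₁ below) y≥) (sym eq)) ∷ rest)
                (later , loopFree-portList (o + size k) xs)
  where
  below = ports-below o k f
  later = portList-atLeast (o + size k) xs

-- Degrees in G_{a,b}, copy by copy

-- Bit lists are read with junk value false past their end; they always have one bit per copy.
firstBit : List Bool → Bool
firstBit []      = false
firstBit (b ∷ _) = b

restBits : List Bool → List Bool
restBits []      = []
restBits (_ ∷ P) = P

hits-∷ : ∀ a as P v → hits (a ∷ as) P v ≡ ind ((v ≡ᵇ a) ∧ firstBit P) + hits as (restBits P) v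
hits-∷ a as []      v = sym (cong (λ b → ind b + 0) (∧-zeroʳ (v ≡ᵇ a)))
hits-∷ a as (b ∷ P) v = refl

hits-[] : ∀ P v → hits [] P v ≡ 0
hits-[] []      v = refl
hits-[] (b ∷ P) v = refl

-- P and Q carry the bits of the dangling edges of the copies towards the previous and the next copy.
copiesDegree : ∀ o arr → Parts Bool arr → List Bool → List Bool → ℕ → ℕ
copiesDegree o []             []      P Q v = 0
copiesDegree o ((k , f) ∷ xs) (m ∷ D) P Q v =
  offsetDegree o (internal k) m v + ind ((v ≡ᵇ proj₁ (ports o f)) ∧ firstBit P) + ind ((v ≡ᵇ proj₂ (ports o f)) ∧ firstBit Q)
  + copiesDegree (o + size k) xs D (restBits P) (restBits Q) v

copiesDegree-split : ∀ o arr D P Q v → copiesDegree o arr D P Q v ≡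
  partsDegree o arr D v + (hits (map proj₁ (portList o arr)) P v + hits (map proj₂ (portList o arr)) Q v)
copiesDegree-split o []             []      P Q v = sym (cong₂ _+_ (hits-[] P v) (hits-[] Q v))
copiesDegree-split o ((k , f) ∷ xs) (m ∷ D) P Q v
  rewrite hits-∷ (proj₁ (ports o f)) (map proj₁ (portList (o + size k) xs)) P v
        | hits-∷ (proj₂ (ports o f)) (map proj₂ (portList (o + size k) xs)) Q v
        | copiesDegree-split (o + size k) xs D (restBits P) (restBits Q) v
  = rearrange (offsetDegree o (internal k) m v) _ _ (partsDegree (o + size k) xs D v) _ _
  where
  rearrange : ∀ a b c d e g → a + b + c + (d + (e + g)) ≡ a + d + (b + e + (c + g))
  rearrange = solve-∀

splitGab : ∀ arr → Vec A (nE (Gab arr)) → Vec A (length (internalEdges 0 arr)) × Vec A (length (connecting (portList 0 arr)))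
splitGab arr = split (internalEdges 0 arr) (connecting (portList 0 arr))

copyParts : ∀ arr → Vec A (nE (Gab arr)) → Parts A arr
copyParts arr M = parts 0 arr (proj₁ (splitGab arr M))

linkBits : ∀ arr → Vec A (nE (Gab arr)) → List A
linkBits arr M = Vec.toList (proj₂ (splitGab arr M))

-- Copy i is joined to copy i+1 by link i, so its dangling edge towards the previous copy is link i-1.
degree-Gab : ∀ arr (M : EdgeSet (Gab arr)) v →
  degree (edges (Gab arr)) M v ≡ copiesDegree 0 arr (copyParts arr M) (rotateʳ (linkBits arr M)) (linkBits arr M) v
degree-Gab arr M v =
  begin
    degree (edges (Gab arr)) M v
  ≡⟨ offsetDegree-split 0 (internalEdges 0 arr) (connecting ports₀) M v ⟩
    degree (internalEdges 0 arr) (proj₁ (splitGab arr M)) v + degree (connecting ports₀) (proj₂ (splitGab arr M)) v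
  ≡⟨ cong₂ _+_ (degree-parts 0 arr (proj₁ (splitGab arr M)) v)
               (degree-connecting ports₀ (proj₂ (splitGab arr M)) v (loopFree-portList 0 arr)) ⟩
    partsDegree 0 arr D v + (hits (map proj₂ ports₀) Q v + hits (map proj₁ ports₀) (rotateʳ Q) v)
  ≡⟨ cong (partsDegree 0 arr D v +_) (+-comm (hits (map proj₂ ports₀) Q v) _) ⟩
    partsDegree 0 arr D v + (hits (map proj₁ ports₀) (rotateʳ Q) v + hits (map proj₂ ports₀) Q v)
  ≡⟨ copiesDegree-split 0 arr D (rotateʳ Q) Q v ⟨
    copiesDegree 0 arr D (rotateʳ Q) Q v
  ∎
  where
  open ≡-Reasoning
  ports₀ = portList 0 arr
  D = copyParts arr M
  Q = linkBits arr M

poleDegree : (k : Kind) → Bool → Subset (length (internal k)) → Bool → Bool → ℕ → ℕ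
poleDegree k f m p q j =
  degree (internal k) m j + ind ((j ≡ᵇ proj₁ (ports 0 f)) ∧ p) + ind ((j ≡ᵇ proj₂ (ports 0 f)) ∧ q)

IsPoleMatching : (k : Kind) → Bool → Subset (length (internal k)) → Bool → Bool → Set
IsPoleMatching k f m p q = ∀ {j} → j < size k → poleDegree k f m p q j ≡ 1

≡ᵇ-+ : ∀ o j x → (o + j ≡ᵇ o + x) ≡ (j ≡ᵇ x)
≡ᵇ-+ zero    j x = refl
≡ᵇ-+ (suc o) j x = ≡ᵇ-+ o j x

≢⇒≡ᵇ≡false : ∀ {v x} → v ≢ x → (v ≡ᵇ x) ≡ false
≢⇒≡ᵇ≡false {v} {x} v≢x with v ≡ᵇ x in eq
... | false = refl
... | true  = ⊥-elim (v≢x (≡ᵇ⇒≡ v x (subst T (sym eq) _)))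

<⇒≡ᵇ-+≡false : ∀ {v o} x → v < o → (v ≡ᵇ o + x) ≡ false
<⇒≡ᵇ-+≡false {o = o} x v<o = ≢⇒≡ᵇ≡false (<⇒≢ (<-≤-trans v<o (m≤m+n o x)))

offsetDegree-+ : ∀ o L m j → offsetDegree o L m (o + j) ≡ degree L m j
offsetDegree-+ o []            m j = refl
offsetDegree-+ o ((x , y) ∷ L) m j
  rewrite ≡ᵇ-+ o j x | ≡ᵇ-+ o j y | offsetDegree-+ o L (tail m) j = refl

offsetDegree-below : ∀ o L m {v} → v < o → offsetDegree o L m v ≡ 0
offsetDegree-below o []            m v<o = refl
offsetDegree-below o ((x , y) ∷ L) m v<o
  rewrite <⇒≡ᵇ-+≡false x v<o | <⇒≡ᵇ-+≡false y v<o = offsetDegree-below o L (tail m) v<o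

ports-shift : ∀ o f → ports o f ≡ shift o (ports 0 f)
ports-shift o false = refl
ports-shift o true  = refl

copiesDegree-below : ∀ o arr D P Q {v} → v < o → copiesDegree o arr D P Q v ≡ 0
copiesDegree-below o []             []      P Q v<o = refl
copiesDegree-below o ((k , f) ∷ xs) (m ∷ D) P Q v<o
  rewrite offsetDegree-below o (internal k) m v<o | ports-shift o f
        | <⇒≡ᵇ-+≡false (proj₁ (ports 0 f)) v<o | <⇒≡ᵇ-+≡false (proj₂ (ports 0 f)) v<o
  = copiesDegree-below (o + size k) xs D (restBits P) (restBits Q) (<-≤-trans v<o (m≤m+n o (size k)))

copiesDegree-inFirst : ∀ o k f xs m D P Q {j} → j < size k →
  copiesDegree o ((k , f) ∷ xs) (m ∷ D) P Q (o + j) ≡ poleDegree k f m (firstBit P) (firstBit Q) j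
copiesDegree-inFirst o k f xs m D P Q {j} j<k
  rewrite offsetDegree-+ o (internal k) m j | ports-shift o f
        | ≡ᵇ-+ o j (proj₁ (ports 0 f)) | ≡ᵇ-+ o j (proj₂ (ports 0 f))
        | copiesDegree-below (o + size k) xs D (restBits P) (restBits Q) (+-monoʳ-< o j<k)
  = +-identityʳ _

degree-beyond : ∀ k m t → degree (internal k) m (size k + t) ≡ 0
degree-beyond kA m t = refl
degree-beyond kB m t = refl

copiesDegree-afterFirst : ∀ o k f xs m D P Q t →
  copiesDegree o ((k , f) ∷ xs) (m ∷ D) P Q (o + (size k + t)) ≡
  copiesDegree (o + size k) xs D (restBits P) (restBits Q) (o + size k + t)
copiesDegree-afterFirst o k f xs m D P Q t
  rewrite offsetDegree-+ o (internal k) m (size k + t) | degree-beyond k m t | ports-shift o f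
        | ≡ᵇ-+ o (size k + t) (proj₁ (ports 0 f)) | ≡ᵇ-+ o (size k + t) (proj₂ (ports 0 f))
        | ≢⇒≡ᵇ≡false (≢-sym (<⇒≢ (<-≤-trans (proj₁ (ports-below 0 k f)) (m≤m+n (size k) t))))
        | ≢⇒≡ᵇ≡false (≢-sym (<⇒≢ (<-≤-trans (proj₂ (ports-below 0 k f)) (m≤m+n (size k) t))))
        | +-assoc o (size k) t
  = refl

AllPoleMatchings : ∀ arr → Parts Bool arr → List Bool → List Bool → Set
AllPoleMatchings []             []      P Q = ⊤
AllPoleMatchings ((k , f) ∷ xs) (m ∷ D) P Q =
  IsPoleMatching k f m (firstBit P) (firstBit Q) × AllPoleMatchings xs D (restBits P) (restBits Q)

copiesDegree≡1⇒AllPoleMatchings : ∀ o arr D P Q →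
  (∀ {j} → j < totalV arr → copiesDegree o arr D P Q (o + j) ≡ 1) → AllPoleMatchings arr D P Q
copiesDegree≡1⇒AllPoleMatchings o []             []      P Q deg = tt
copiesDegree≡1⇒AllPoleMatchings o ((k , f) ∷ xs) (m ∷ D) P Q deg =
  (λ j<k → trans (sym (copiesDegree-inFirst o k f xs m D P Q j<k)) (deg (<-≤-trans j<k (m≤m+n (size k) (totalV xs))))) ,
  copiesDegree≡1⇒AllPoleMatchings (o + size k) xs D (restBits P) (restBits Q)
    (λ {t} t<n → trans (sym (copiesDegree-afterFirst o k f xs m D P Q t)) (deg (+-monoʳ-< (size k) t<n)))

AllPoleMatchings⇒copiesDegree≡1 : ∀ o arr D P Q → AllPoleMatchings arr D P Q →
  ∀ {j} → j < totalV arr → copiesDegree o arr D P Q (o + j) ≡ 1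
AllPoleMatchings⇒copiesDegree≡1 o ((k , f) ∷ xs) (m ∷ D) P Q (pm , pms) {j} j<n with j <? size k
... | yes j<k = trans (copiesDegree-inFirst o k f xs m D P Q j<k) (pm j<k)
... | no  j≮k with m≤n⇒∃[o]m+o≡n (≮⇒≥ j≮k)
...   | t , refl = trans (copiesDegree-afterFirst o k f xs m D P Q t)
                         (AllPoleMatchings⇒copiesDegree≡1 (o + size k) xs D (restBits P) (restBits Q) pms (+-cancelˡ-< (size k) t _ j<n))

perfectMatching⇒AllPoleMatchings : ∀ arr M → IsPerfectMatching (Gab arr) M →
  AllPoleMatchings arr (copyParts arr M) (rotateʳ (linkBits arr M)) (linkBits arr M)
perfectMatching⇒AllPoleMatchings arr M pm = copiesDegree≡1⇒AllPoleMatchings 0 arr _ _ _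
  (λ {j} j<n → trans (sym (degree-Gab arr M j)) (perfectMatching⇒degree≡1 (Gab arr) M pm j j<n))

AllPoleMatchings⇒perfectMatching : ∀ arr M →
  AllPoleMatchings arr (copyParts arr M) (rotateʳ (linkBits arr M)) (linkBits arr M) → IsPerfectMatching (Gab arr) M
AllPoleMatchings⇒perfectMatching arr M pms = degree≡1⇒perfectMatching (Gab arr) M
  (λ v v<n → trans (degree-Gab arr M v) (AllPoleMatchings⇒copiesDegree≡1 0 arr _ _ _ pms v<n))

_∪ₚ_ : ∀ {arr} → Parts Bool arr → Parts Bool arr → Parts Bool arr
D ∪ₚ D′ = All.zipWith (uncurry _∪_) (D , D′)

infixr 6 _∪ₚ_

coverCount : ∀ arr → (D₁ D₂ D₃ : Parts Bool arr) → (Q₁ Q₂ Q₃ : List Bool) → ℕ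
coverCount []       []        []        []        Q₁ Q₂ Q₃ = 0
coverCount (_ ∷ xs) (m₁ ∷ D₁) (m₂ ∷ D₂) (m₃ ∷ D₃) Q₁ Q₂ Q₃ =
  ∣ m₁ ∪ m₂ ∪ m₃ ∣ + ind (firstBit Q₁ ∨ firstBit Q₂ ∨ firstBit Q₃)
  + coverCount xs D₁ D₂ D₃ (restBits Q₁) (restBits Q₂) (restBits Q₃)

∣∣-∷ : ∀ {n} b (c : Subset n) → ∣ b ∷ c ∣ ≡ ind b + ∣ c ∣
∣∣-∷ true  c = refl
∣∣-∷ false c = refl

coverCount-split : ∀ arr D₁ D₂ D₃ {n} (c₁ c₂ c₃ : Subset n) → n ≡ length arr →
  partsSize (D₁ ∪ₚ D₂ ∪ₚ D₃) + ∣ c₁ ∪ c₂ ∪ c₃ ∣ ≡ coverCount arr D₁ D₂ D₃ (Vec.toList c₁) (Vec.toList c₂) (Vec.toList c₃)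
coverCount-split []       []        []        []        []         []         []         eq = refl
coverCount-split (_ ∷ xs) (m₁ ∷ D₁) (m₂ ∷ D₂) (m₃ ∷ D₃) (b₁ ∷ c₁) (b₂ ∷ c₂) (b₃ ∷ c₃) eq
  rewrite ∣∣-∷ (b₁ ∨ b₂ ∨ b₃) (c₁ ∪ c₂ ∪ c₃)
        | sym (coverCount-split xs D₁ D₂ D₃ c₁ c₂ c₃ (suc-injective eq))
  = interchange +-commutativeSemigroup (∣ m₁ ∪ m₂ ∪ m₃ ∣) (partsSize (D₁ ∪ₚ D₂ ∪ₚ D₃)) (ind (b₁ ∨ b₂ ∨ b₃)) (∣ c₁ ∪ c₂ ∪ c₃ ∣)

splitGab-∪ : ∀ arr (M M′ : EdgeSet (Gab arr)) →
  splitGab arr (M ∪ M′) ≡ (proj₁ (splitGab arr M) ∪ proj₁ (splitGab arr M′) , proj₂ (splitGab arr M) ∪ proj₂ (splitGab arr M′))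
splitGab-∪ arr = split-zipWith _∨_ (internalEdges 0 arr) (connecting (portList 0 arr))

parts-∪ : ∀ o arr (m m′ : Subset (length (internalEdges o arr))) → parts o arr (m ∪ m′) ≡ parts o arr m ∪ₚ parts o arr m′
parts-∪ = parts-zipWith _∨_

length-portList : ∀ o arr → length (portList o arr) ≡ length arr
length-portList o []             = refl
length-portList o ((k , _) ∷ xs) = cong suc (length-portList (o + size k) xs)

length-links : ∀ arr → length (connecting (portList 0 arr)) ≡ length arr
length-links arr = trans (length-connecting (portList 0 arr)) (length-portList 0 arr)

∣∣-Gab : ∀ arr (M₁ M₂ M₃ : EdgeSet (Gab arr)) → ∣ M₁ ∪ M₂ ∪ M₃ ∣ ≡
  coverCount arr (copyParts arr M₁) (copyParts arr M₂) (copyParts arr M₃) (linkBits arr M₁) (linkBits arr M₂) (linkBits arr M₃)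
∣∣-Gab arr M₁ M₂ M₃ =
  begin
    ∣ M₁ ∪ M₂ ∪ M₃ ∣
  ≡⟨ ∣∣-split (internalEdges 0 arr) (connecting (portList 0 arr)) (M₁ ∪ M₂ ∪ M₃) ⟩
    ∣ proj₁ (splitGab arr (M₁ ∪ M₂ ∪ M₃)) ∣ + ∣ proj₂ (splitGab arr (M₁ ∪ M₂ ∪ M₃)) ∣
  ≡⟨ cong (λ s → ∣ proj₁ s ∣ + ∣ proj₂ s ∣)
          (trans (splitGab-∪ arr M₁ (M₂ ∪ M₃)) (cong (λ s → (i₁ ∪ proj₁ s , c₁ ∪ proj₂ s)) (splitGab-∪ arr M₂ M₃))) ⟩
    ∣ i₁ ∪ i₂ ∪ i₃ ∣ + ∣ c₁ ∪ c₂ ∪ c₃ ∣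
  ≡⟨ cong (_+ ∣ c₁ ∪ c₂ ∪ c₃ ∣) (∣∣-parts 0 arr (i₁ ∪ i₂ ∪ i₃)) ⟩
    partsSize (parts 0 arr (i₁ ∪ i₂ ∪ i₃)) + ∣ c₁ ∪ c₂ ∪ c₃ ∣
  ≡⟨ cong (λ D → partsSize D + ∣ c₁ ∪ c₂ ∪ c₃ ∣)
          (trans (parts-∪ 0 arr i₁ (i₂ ∪ i₃)) (cong (parts 0 arr i₁ ∪ₚ_) (parts-∪ 0 arr i₂ i₃))) ⟩
    partsSize (copyParts arr M₁ ∪ₚ copyParts arr M₂ ∪ₚ copyParts arr M₃) + ∣ c₁ ∪ c₂ ∪ c₃ ∣
  ≡⟨ coverCount-split arr _ _ _ c₁ c₂ c₃ (length-links arr) ⟩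
    coverCount arr (copyParts arr M₁) (copyParts arr M₂) (copyParts arr M₃) (linkBits arr M₁) (linkBits arr M₂) (linkBits arr M₃)
  ∎
  where
  open ≡-Reasoning
  i₁ = proj₁ (splitGab arr M₁)
  i₂ = proj₁ (splitGab arr M₂)
  i₃ = proj₁ (splitGab arr M₃)
  c₁ = proj₂ (splitGab arr M₁)
  c₂ = proj₂ (splitGab arr M₂)
  c₃ = proj₂ (splitGab arr M₃)

-- Local perfect matchings of A and B

isPoleMatching? : ∀ k f m p q → Dec (IsPoleMatching k f m p q)
isPoleMatching? k f m p q = allUpTo? (λ j → poleDegree k f m p q j ≟ 1) (size k)

poleMatching-flip : ∀ k f m p q → IsPoleMatching k f m p q → IsPoleMatching k (not f) m q p
poleMatching-flip k false m p q pm {j} j<k = trans (xy∙z≈xz∙y +-commutativeSemigroup (degree (internal k) m j) _ _) (pm j<k)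
poleMatching-flip k true  m p q pm {j} j<k = trans (xy∙z≈xz∙y +-commutativeSemigroup (degree (internal k) m j) _ _) (pm j<k)

allSubsets? : ∀ {n} {P : Subset n → Set} → Decidable P → Dec (∀ s → P s)
allSubsets? P? = map′ (λ ¬∃¬ s → decidable-stable (P? s) (λ ¬Ps → ¬∃¬ (s , ¬Ps)))
                      (λ ∀P (s , ¬Ps) → ¬Ps (∀P s))
                      (¬? (anySubset? (λ s → ¬? (P? s))))

PoleState : Kind → Set
PoleState k = Subset (length (internal k)) × Bool × Bool

_≟ₛ_ : (s s′ : PoleState kA) → Dec (s ≡ s′)
_≟ₛ_ = ≡-dec (Vec.≡-dec Bool._≟_) (≡-dec Bool._≟_ Bool._≟_)

open import Data.List.Membership.DecPropositional _≟ₛ_ using (_∈?_) renaming (_∈_ to _∈ₗ_)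

-- The six perfect matchings of the Petersen graph; one of the two dangling edges
-- of A is in such a matching exactly when the cut edge uv is.
petersenMatchings : List (PoleState kA)
petersenMatchings =
    ((o ∷ o ∷ o ∷ o ∷ I ∷ I ∷ I ∷ I ∷ I ∷ o ∷ o ∷ o ∷ o ∷ o ∷ []) , o , o)
  ∷ ((o ∷ o ∷ I ∷ o ∷ o ∷ o ∷ I ∷ o ∷ o ∷ o ∷ o ∷ o ∷ I ∷ I ∷ []) , I , I)
  ∷ ((o ∷ I ∷ o ∷ o ∷ o ∷ o ∷ o ∷ o ∷ I ∷ I ∷ I ∷ o ∷ o ∷ o ∷ []) , I , I)
  ∷ ((o ∷ I ∷ o ∷ I ∷ o ∷ I ∷ o ∷ o ∷ o ∷ o ∷ o ∷ I ∷ I ∷ o ∷ []) , o , o)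
  ∷ ((I ∷ o ∷ o ∷ I ∷ o ∷ o ∷ o ∷ I ∷ o ∷ I ∷ o ∷ o ∷ o ∷ I ∷ []) , o , o)
  ∷ ((I ∷ o ∷ I ∷ o ∷ I ∷ o ∷ o ∷ o ∷ o ∷ o ∷ I ∷ I ∷ o ∷ o ∷ []) , o , o)
  ∷ []
  where
  I o : Bool
  I = true
  o = false

petersenComplete? : ∀ p q → Dec (∀ m → IsPoleMatching kA false m p q → (m , p , q) ∈ₗ petersenMatchings)
petersenComplete? p q = allSubsets? (λ m → isPoleMatching? kA false m p q →-dec ((m , p , q) ∈? petersenMatchings))

poleMatching⇒∈petersenMatchings : ∀ m p q → IsPoleMatching kA false m p q → (m , p , q) ∈ₗ petersenMatchings
poleMatching⇒∈petersenMatchings m false false = toWitness {a? = petersenComplete? false false} _ m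
poleMatching⇒∈petersenMatchings m false true  = toWitness {a? = petersenComplete? false true} _ m
poleMatching⇒∈petersenMatchings m true  false = toWitness {a? = petersenComplete? true false} _ m
poleMatching⇒∈petersenMatchings m true  true  = toWitness {a? = petersenComplete? true true} _ m

-- Two distinct perfect matchings of the Petersen graph share exactly one edge,
-- so three of them cover at most 15 − 3 = 12 edges.
PetersenCover : PoleState kA → PoleState kA → PoleState kA → Set
PetersenCover (m₁ , p₁ , q₁) (m₂ , p₂ , q₂) (m₃ , p₃ , q₃) =
  ∣ m₁ ∪ m₂ ∪ m₃ ∣ + ind (p₁ ∨ p₂ ∨ p₃) ≤ 12 × ∣ m₁ ∪ m₂ ∪ m₃ ∣ + ind (q₁ ∨ q₂ ∨ q₃) ≤ 12

petersenCover? : ∀ x y z → Dec (PetersenCover x y z)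
petersenCover? (m₁ , p₁ , q₁) (m₂ , p₂ , q₂) (m₃ , p₃ , q₃) = (_ ≤? 12) ×-dec (_ ≤? 12)

petersenCover : ∀ {x y z} → x ∈ₗ petersenMatchings → y ∈ₗ petersenMatchings → z ∈ₗ petersenMatchings → PetersenCover x y z
petersenCover x∈ y∈ z∈ = All.lookup (All.lookup (All.lookup allTriples x∈) y∈) z∈
  where
  allTriples : All (λ x → All (λ y → All (PetersenCover x y) petersenMatchings) petersenMatchings) petersenMatchings
  allTriples = toWitness {a? = All.all? (λ x → All.all? (λ y → All.all? (petersenCover? x y)
                                 petersenMatchings) petersenMatchings) petersenMatchings} _

capacity : Kind → ℕ
capacity kA = 12
capacity kB = 6

copyCover≤capacity : ∀ k f {m₁ m₂ m₃ p₁ p₂ p₃ q₁ q₂ q₃} →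
  IsPoleMatching k f m₁ p₁ q₁ → IsPoleMatching k f m₂ p₂ q₂ → IsPoleMatching k f m₃ p₃ q₃ →
  ∣ m₁ ∪ m₂ ∪ m₃ ∣ + ind (q₁ ∨ q₂ ∨ q₃) ≤ capacity k
copyCover≤capacity kA false {m₁} {m₂} {m₃} {p₁} {p₂} {p₃} {q₁} {q₂} {q₃} pm₁ pm₂ pm₃ =
  proj₂ (petersenCover (poleMatching⇒∈petersenMatchings m₁ p₁ q₁ pm₁)
                       (poleMatching⇒∈petersenMatchings m₂ p₂ q₂ pm₂)
                       (poleMatching⇒∈petersenMatchings m₃ p₃ q₃ pm₃))
copyCover≤capacity kA true {m₁} {m₂} {m₃} {p₁} {p₂} {p₃} {q₁} {q₂} {q₃} pm₁ pm₂ pm₃ =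
  proj₁ (petersenCover (poleMatching⇒∈petersenMatchings m₁ q₁ p₁ (poleMatching-flip kA true m₁ p₁ q₁ pm₁))
                       (poleMatching⇒∈petersenMatchings m₂ q₂ p₂ (poleMatching-flip kA true m₂ p₂ q₂ pm₂))
                       (poleMatching⇒∈petersenMatchings m₃ q₃ p₃ (poleMatching-flip kA true m₃ p₃ q₃ pm₃)))
copyCover≤capacity kB f {m₁} {m₂} {m₃} {q₁ = q₁} {q₂} {q₃} _ _ _ = +-mono-≤ (∣p∣≤n (m₁ ∪ m₂ ∪ m₃)) (ind≤1 (q₁ ∨ q₂ ∨ q₃))
  where
  ind≤1 : ∀ b → ind b ≤ 1
  ind≤1 true  = ≤-refl
  ind≤1 false = z≤n

kindWeight : ℕ → ℕ → Kind → ℕ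
kindWeight x y kA = x
kindWeight x y kB = y

weightedCount-∷ : ∀ x y k f xs →
  x * countA ((k , f) ∷ xs) + y * countB ((k , f) ∷ xs) ≡ kindWeight x y k + (x * countA xs + y * countB xs)
weightedCount-∷ x y kA f xs = stepA x y (countA xs) (countB xs)
  where
  stepA : ∀ x y a b → x * suc a + y * b ≡ x + (x * a + y * b)
  stepA = solve-∀
weightedCount-∷ x y kB f xs = stepB x y (countA xs) (countB xs)
  where
  stepB : ∀ x y a b → x * a + y * suc b ≡ y + (x * a + y * b)
  stepB = solve-∀

totalCapacity : Arrangement → ℕ
totalCapacity []             = 0
totalCapacity ((k , _) ∷ xs) = capacity k + totalCapacity xs

totalCapacity≡ : ∀ arr → totalCapacity arr ≡ 12 * countA arr + 6 * countB arr
totalCapacity≡ []             = refl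
totalCapacity≡ ((k , f) ∷ xs) =
  trans (cong (capacity k +_) (totalCapacity≡ xs)) (sym (trans (weightedCount-∷ 12 6 k f xs) (cong (_+ _) (capacity≡ k))))
  where
  capacity≡ : ∀ k → kindWeight 12 6 k ≡ capacity k
  capacity≡ kA = refl
  capacity≡ kB = refl

coverCount≤totalCapacity : ∀ arr {D₁ D₂ D₃ P₁ P₂ P₃ Q₁ Q₂ Q₃} →
  AllPoleMatchings arr D₁ P₁ Q₁ → AllPoleMatchings arr D₂ P₂ Q₂ → AllPoleMatchings arr D₃ P₃ Q₃ →
  coverCount arr D₁ D₂ D₃ Q₁ Q₂ Q₃ ≤ totalCapacity arr
coverCount≤totalCapacity []             {[]} {[]} {[]} _ _ _ = z≤n
coverCount≤totalCapacity ((k , f) ∷ xs) {_ ∷ _} {_ ∷ _} {_ ∷ _} (pm₁ , pms₁) (pm₂ , pms₂) (pm₃ , pms₃) =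
  +-mono-≤ (copyCover≤capacity k f pm₁ pm₂ pm₃) (coverCount≤totalCapacity xs pms₁ pms₂ pms₃)

∣∣-perfectMatchings≤totalCapacity : ∀ arr (M₁ M₂ M₃ : EdgeSet (Gab arr)) →
  IsPerfectMatching (Gab arr) M₁ → IsPerfectMatching (Gab arr) M₂ → IsPerfectMatching (Gab arr) M₃ →
  ∣ M₁ ∪ M₂ ∪ M₃ ∣ ≤ totalCapacity arr
∣∣-perfectMatchings≤totalCapacity arr M₁ M₂ M₃ pm₁ pm₂ pm₃ =
  subst (_≤ totalCapacity arr) (sym (∣∣-Gab arr M₁ M₂ M₃))
    (coverCount≤totalCapacity arr (perfectMatching⇒AllPoleMatchings arr M₁ pm₁)
                                  (perfectMatching⇒AllPoleMatchings arr M₂ pm₂)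
                                  (perfectMatching⇒AllPoleMatchings arr M₃ pm₃))

-- Three perfect matchings attaining the bound

-- For A these are Petersen matchings that pairwise share exactly one edge, the first containing uv.
optimal₁ optimal₂ optimal₃ : (k : Kind) → Subset (length (internal k))
optimal₁ kA = false ∷ false ∷ true  ∷ false ∷ false ∷ false ∷ true  ∷ false ∷ false ∷ false ∷ false ∷ false ∷ true  ∷ true  ∷ []
optimal₁ kB = false ∷ false ∷ false ∷ false ∷ true ∷ []
optimal₂ kA = false ∷ false ∷ false ∷ false ∷ true  ∷ true  ∷ true  ∷ true  ∷ true  ∷ false ∷ false ∷ false ∷ false ∷ false ∷ []
optimal₂ kB = true ∷ false ∷ false ∷ true ∷ false ∷ []
optimal₃ kA = false ∷ true  ∷ false ∷ true  ∷ false ∷ true  ∷ false ∷ false ∷ false ∷ false ∷ false ∷ true  ∷ true  ∷ false ∷ []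
optimal₃ kB = false ∷ true ∷ true ∷ false ∷ false ∷ []

uniformMatching : ((k : Kind) → Subset (length (internal k))) → Bool → ∀ arr → EdgeSet (Gab arr)
uniformMatching c b arr =
  join (internalEdges 0 arr) (connecting (portList 0 arr)) (unparts 0 arr (All.universal (c ∘ proj₁) arr)) (Vec.replicate _ b)

copyParts-uniformMatching : ∀ c b arr → copyParts arr (uniformMatching c b arr) ≡ All.universal (c ∘ proj₁) arr
copyParts-uniformMatching c b arr
  rewrite split-join (internalEdges 0 arr) (connecting (portList 0 arr)) (unparts 0 arr (All.universal (c ∘ proj₁) arr)) (Vec.replicate _ b)
  = parts-unparts 0 arr (All.universal (c ∘ proj₁) arr)

linkBits-uniformMatching : ∀ c b arr → linkBits arr (uniformMatching c b arr) ≡ List.replicate (length arr) b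
linkBits-uniformMatching c b arr
  rewrite split-join (internalEdges 0 arr) (connecting (portList 0 arr)) (unparts 0 arr (All.universal (c ∘ proj₁) arr)) (Vec.replicate _ b)
  = trans (Vec.toList-replicate _ b) (cong (λ n → List.replicate n b) (length-links arr))

rotateʳ-replicate : ∀ {A : Set} n (x : A) → rotateʳ (List.replicate n x) ≡ List.replicate n x
rotateʳ-replicate zero    x = refl
rotateʳ-replicate (suc n) x = cong₂ _∷_ (lastOf-replicate n) (initOf-replicate n)
  where
  lastOf-replicate : ∀ n → lastOf x (List.replicate n x) ≡ x
  lastOf-replicate zero    = refl
  lastOf-replicate (suc n) = lastOf-replicate n
  initOf-replicate : ∀ n → initOf x (List.replicate n x) ≡ List.replicate n x
  initOf-replicate zero    = refl
  initOf-replicate (suc n) = cong (x ∷_) (initOf-replicate n)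

allPoleMatchings-uniform : ∀ c b → (∀ k f → IsPoleMatching k f (c k) b b) →
  ∀ arr → AllPoleMatchings arr (All.universal (c ∘ proj₁) arr) (List.replicate (length arr) b) (List.replicate (length arr) b)
allPoleMatchings-uniform c b pm []             = tt
allPoleMatchings-uniform c b pm ((k , f) ∷ xs) = pm k f , allPoleMatchings-uniform c b pm xs

uniformMatching-isPerfectMatching : ∀ c b → (∀ k f → IsPoleMatching k f (c k) b b) →
  ∀ arr → IsPerfectMatching (Gab arr) (uniformMatching c b arr)
uniformMatching-isPerfectMatching c b pm arr =
  AllPoleMatchings⇒perfectMatching arr (uniformMatching c b arr)
    (subst₂ (λ D Q → AllPoleMatchings arr D (rotateʳ Q) Q)
            (sym (copyParts-uniformMatching c b arr)) (sym (linkBits-uniformMatching c b arr))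
            (subst (λ P → AllPoleMatchings arr D P Q) (sym (rotateʳ-replicate (length arr) b))
                   (allPoleMatchings-uniform c b pm arr)))
  where
  D = All.universal (c ∘ proj₁) arr
  Q = List.replicate (length arr) b

isPoleMatching-bothWays : ∀ k m b → {True (isPoleMatching? k false m b b)} → ∀ f → IsPoleMatching k f m b b
isPoleMatching-bothWays k m b {t} false = toWitness t
isPoleMatching-bothWays k m b {t} true  = poleMatching-flip k false m b b (toWitness t)

optimal₁-isPoleMatching : ∀ k f → IsPoleMatching k f (optimal₁ k) true true
optimal₁-isPoleMatching kA = isPoleMatching-bothWays kA (optimal₁ kA) true
optimal₁-isPoleMatching kB = isPoleMatching-bothWays kB (optimal₁ kB) true

optimal₂-isPoleMatching : ∀ k f → IsPoleMatching k f (optimal₂ k) false false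
optimal₂-isPoleMatching kA = isPoleMatching-bothWays kA (optimal₂ kA) false
optimal₂-isPoleMatching kB = isPoleMatching-bothWays kB (optimal₂ kB) false

optimal₃-isPoleMatching : ∀ k f → IsPoleMatching k f (optimal₃ k) false false
optimal₃-isPoleMatching kA = isPoleMatching-bothWays kA (optimal₃ kA) false
optimal₃-isPoleMatching kB = isPoleMatching-bothWays kB (optimal₃ kB) false

coverCount-optimal : ∀ arr →
  coverCount arr (All.universal (optimal₁ ∘ proj₁) arr) (All.universal (optimal₂ ∘ proj₁) arr) (All.universal (optimal₃ ∘ proj₁) arr)
                 (List.replicate (length arr) true) (List.replicate (length arr) false) (List.replicate (length arr) false)
  ≡ totalCapacity arr
coverCount-optimal []             = refl
coverCount-optimal ((k , _) ∷ xs) = cong₂ _+_ (copyCover-optimal k) (coverCount-optimal xs)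
  where
  copyCover-optimal : ∀ k → ∣ optimal₁ k ∪ optimal₂ k ∪ optimal₃ k ∣ + 1 ≡ capacity k
  copyCover-optimal kA = refl
  copyCover-optimal kB = refl

∣∣-optimal : ∀ arr →
  ∣ uniformMatching optimal₁ true arr ∪ uniformMatching optimal₂ false arr ∪ uniformMatching optimal₃ false arr ∣ ≡ totalCapacity arr
∣∣-optimal arr
  rewrite ∣∣-Gab arr (uniformMatching optimal₁ true arr) (uniformMatching optimal₂ false arr) (uniformMatching optimal₃ false arr)
        | copyParts-uniformMatching optimal₁ true arr | copyParts-uniformMatching optimal₂ false arr
        | copyParts-uniformMatching optimal₃ false arr
        | linkBits-uniformMatching optimal₁ true arr | linkBits-uniformMatching optimal₂ false arr
        | linkBits-uniformMatching optimal₃ false arr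
  = coverCount-optimal arr

length-internalEdges : ∀ o arr → length (internalEdges o arr) ≡ 14 * countA arr + 5 * countB arr
length-internalEdges o []             = refl
length-internalEdges o ((k , f) ∷ xs) =
  trans (List.length-++ (List.map (shift o) (internal k)))
        (trans (cong₂ _+_ (List.length-map (shift o) (internal k)) (length-internalEdges (o + size k) xs))
               (sym (trans (weightedCount-∷ 14 5 k f xs) (cong (_+ _) (edges≡ k)))))
  where
  edges≡ : ∀ k → kindWeight 14 5 k ≡ length (internal k)
  edges≡ kA = refl
  edges≡ kB = refl

length≡countA+countB : ∀ arr → length arr ≡ countA arr + countB arr
length≡countA+countB []              = refl
length≡countA+countB ((kA , _) ∷ xs) = cong suc (length≡countA+countB xs)
length≡countA+countB ((kB , _) ∷ xs) = trans (cong suc (length≡countA+countB xs)) (sym (+-suc (countA xs) (countB xs)))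

nE-Gab : ∀ arr → nE (Gab arr) ≡ 15 * countA arr + 6 * countB arr
nE-Gab arr =
  trans (List.length-++ (internalEdges 0 arr))
        (trans (cong₂ _+_ (length-internalEdges 0 arr) (trans (length-links arr) (length≡countA+countB arr)))
               (collect (countA arr) (countB arr)))
  where
  collect : ∀ a b → 14 * a + 5 * b + (a + b) ≡ 15 * a + 6 * b
  collect = solve-∀

totalCapacity-ratio : ∀ arr →
  totalCapacity arr * (5 * countA arr + 2 * countB arr) ≡ (4 * countA arr + 2 * countB arr) * nE (Gab arr)
totalCapacity-ratio arr =
  begin
    totalCapacity arr * (5 * a + 2 * b)        ≡⟨ cong (_* (5 * a + 2 * b)) (totalCapacity≡ arr) ⟩
    (12 * a + 6 * b) * (5 * a + 2 * b)         ≡⟨ ratio a b ⟩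
    (4 * a + 2 * b) * (15 * a + 6 * b)         ≡⟨ cong ((4 * a + 2 * b) *_) (nE-Gab arr) ⟨
    (4 * a + 2 * b) * nE (Gab arr)             ∎
  where
  open ≡-Reasoning
  a = countA arr
  b = countB arr
  ratio : ∀ a b → (12 * a + 6 * b) * (5 * a + 2 * b) ≡ (4 * a + 2 * b) * (15 * a + 6 * b)
  ratio = solve-∀

lemma3 : (a b : ℕ) → 1 ≤ a → (arr : Arrangement) → countA arr ≡ a → countB arr ≡ b →
    m3≡ (Gab arr) (4 * a + 2 * b) (5 * a + 2 * b)
lemma3 _ _ _ arr refl refl =
  totalCapacity arr ,
  ( ( uniformMatching optimal₁ true arr , uniformMatching optimal₂ false arr , uniformMatching optimal₃ false arr
    , uniformMatching-isPerfectMatching optimal₁ true optimal₁-isPoleMatching arr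
    , uniformMatching-isPerfectMatching optimal₂ false optimal₂-isPoleMatching arr
    , uniformMatching-isPerfectMatching optimal₃ false optimal₃-isPoleMatching arr
    , ∣∣-optimal arr )
  , ∣∣-perfectMatchings≤totalCapacity arr ) ,
  totalCapacity-ratio arr
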